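{- Let $\tau$ be an arbitrary pattern (partition) and let $\sigma=1(\tau+1)$. Then for every $n\ge 1$, \[p(n;\sigma)=\sum_{i=0}^{n-1}\binom{n-1}{i}p(i;\tau).\] Equivalently, if $F(x)=\sum_{n\ge0}p(n;\tau)x^n/n!$ and $G(x)=\sum_{n\ge 0}p(n;\sigma)x^n/n!$, then $G(x)=1+\int_0^x F(t)e^t\,dt$.
   Context: Partitions of $[n]$ are identified with canonical sequences $\pi_1\cdots\pi_n$ ($\pi_i=j$ iff $i$ lies in the $j$-th block, blocks ordered by increasing minima). A partition $\pi$ contains a pattern $\sigma$ if it has a subsequence order-isomorphic to $\sigma$, and avoids it otherwise. $P(n;\sigma)$ is the set of partitions of $[n]$ avoiding $\sigma$ and $p(n;\sigma)=|P(n;\sigma)|$; in particular $p(0;\sigma)=1$ (the empty partition) for nonempty $\sigma$. For a sequence $S=s_1\cdots s_p$ and integer $k$, $S+k$ denotes $(s_1+k)\cdots(s_p+k)$, and $1(\tau+1)$ denotes concatenation. -}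

module Defs where

open import Data.Nat using (ℕ; zero; suc; _≤_; _<_; _⊔_; _≤?_; _<?_)
open import Data.Nat.Properties using (_≟_)
open import Data.Fin using (Fin; cast)
open import Data.Fin.Properties using (all?)
open import Data.List using (List; []; _∷_; [_]; map; _++_; length; lookup; filter; concatMap; applyUpTo)
open import Data.List.Relation.Binary.Sublist.Propositional using (_⊆_; []; _∷_; _∷ʳ_)
open import Data.List.Membership.Propositional using (_∈_)
open import Data.List.Membership.Propositional.Properties using (∈-map⁺; ∈-map⁻; ∈-++⁺ˡ; ∈-++⁺ʳ; ∈-++⁻)
open import Data.List.Relation.Unary.Any using (Any; here; there; any?)
open import Data.List.Relation.Unary.Any.Properties using (Any-cong)
open import Data.Product using (Σ; ∃; _×_; _,_; proj₁; proj₂)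
open import Data.Sum using (inj₁; inj₂)
open import Relation.Nullary using (Dec; yes; no; ¬_; ¬?; _×-dec_)
open import Relation.Nullary.Decidable using (map′)
open import Relation.Binary.PropositionalEquality using (_≡_; refl; subst)
open import Function.Bundles using (_⇔_; mk⇔; Equivalence)
open import Function.Base using (_∘_)

-- Set partitions of [n] as canonical sequences (restricted growth
-- functions), with values 1,2,3,...  `RGS m π` : π is a valid
-- continuation when the blocks used so far are 1..m, i.e. each entry is
-- ≥ 1 and at most 1 + (maximum of the preceding entries).

data RGS : ℕ → List ℕ → Set where
  []  : ∀ {m} → RGS m []
  _∷_ : ∀ {m x xs} → (1 ≤ x × x ≤ suc m) → RGS (m ⊔ x) xs → RGS m (x ∷ xs)

Canonical : List ℕ → Set
Canonical π = RGS 0 π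

OrderIso : List ℕ → List ℕ → Set
OrderIso s t = Σ (length s ≡ length t) λ eq →
  (i j : Fin (length s)) →
    (lookup s i < lookup s j) ⇔ (lookup t (cast eq i) < lookup t (cast eq j))

Contains : List ℕ → List ℕ → Set
Contains π σ = ∃ λ s → s ⊆ π × OrderIso s σ

Avoids : List ℕ → List ℕ → Set
Avoids π σ = ¬ Contains π σ

rgs? : ∀ m xs → Dec (RGS m xs)
rgs? m [] = yes []
rgs? m (x ∷ xs) with (1 ≤? x ×-dec x ≤? suc m) | rgs? (m ⊔ x) xs
... | yes p | yes q = yes (p ∷ q)
... | no ¬p | _ = no λ { (p ∷ _) → ¬p p }
... | yes _ | no ¬q = no λ { (_ ∷ q) → ¬q q }

_⇔?_ : ∀ {A B : Set} → Dec A → Dec B → Dec (A ⇔ B)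
yes a ⇔? yes b = yes (mk⇔ (λ _ → b) (λ _ → a))
yes a ⇔? no ¬b = no λ e → ¬b (Equivalence.to e a)
no ¬a ⇔? yes b = no λ e → ¬a (Equivalence.from e b)
no ¬a ⇔? no ¬b = yes (mk⇔ (λ a → ⊥-elim' (¬a a)) (λ b → ⊥-elim' (¬b b)))
  where
  open import Data.Empty using () renaming (⊥-elim to ⊥-elim')

orderIso? : ∀ s t → Dec (OrderIso s t)
orderIso? s t with length s ≟ length t
... | no ne = no (ne ∘ proj₁)
... | yes eq with all? (λ i → all? (λ j →
                 (lookup s i <? lookup s j) ⇔?
                 (lookup t (cast eq i) <? lookup t (cast eq j))))
...   | yes f = yes (eq , f)
...   | no ¬f = no λ { (_ , f) → ¬f f }

sublists : List ℕ → List (List ℕ)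
sublists [] = [ [] ]
sublists (x ∷ xs) = map (x ∷_) (sublists xs) ++ sublists xs

sublists-complete : ∀ {s π} → s ⊆ π → s ∈ sublists π
sublists-complete [] = here refl
sublists-complete (_∷ʳ_ {ys = ys} x p) = ∈-++⁺ʳ (map (x ∷_) (sublists ys)) (sublists-complete p)
sublists-complete (refl ∷ p) = ∈-++⁺ˡ (∈-map⁺ (_ ∷_) (sublists-complete p))

sublists-sound : ∀ {s} π → s ∈ sublists π → s ⊆ π
sublists-sound [] (here refl) = []
sublists-sound (x ∷ xs) m with ∈-++⁻ (map (x ∷_) (sublists xs)) m
... | inj₂ m′ = x ∷ʳ sublists-sound xs m′
... | inj₁ m′ with ∈-map⁻ (x ∷_) m′
...   | (s′ , m″ , refl) = refl ∷ sublists-sound xs m″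

contains? : ∀ π σ → Dec (Contains π σ)
contains? π σ = map′ to from (any? (λ s → orderIso? s σ) (sublists π))
  where
  open import Data.List.Relation.Unary.Any using (satisfied)
  open import Data.List.Membership.Propositional using (find; lose)
  to : Any (λ s → OrderIso s σ) (sublists π) → Contains π σ
  to a with find a
  ... | (s , m , iso) = s , sublists-sound π m , iso
  from : Contains π σ → Any (λ s → OrderIso s σ) (sublists π)
  from (s , sub , iso) = lose (sublists-complete sub) iso

words : ℕ → ℕ → List (List ℕ)
words k zero = [ [] ]
words k (suc n) = concatMap (λ x → map (x ∷_) (words k n)) (applyUpTo suc k)

p : ℕ → List ℕ → ℕ
p n σ = length (filter (λ π → rgs? 0 π ×-dec ¬? (contains? π σ)) (words n n))

-- The first entry of a partition of [n+1] is 1, and an occurrence of 1(τ+1) may always use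
-- it as its 1, since the other letters of the occurrence exceed its first one, hence 1.
-- So π avoids 1(τ+1) iff the partition obtained by deleting the block of 1 and lowering every
-- other label by one avoids τ.  Conversely π is recovered from that smaller partition of [i]
-- together with the i positions among 2, …, n+1 lying outside the block of 1, which gives the
-- binomial sum.  Both sides are counted as lengths of duplicate-free lists with the same members.
module Submission where

open import Defs
open import Data.Bool using (Bool; true; false)
open import Data.Empty using (⊥-elim)
open import Data.Fin using (Fin; cast) renaming (zero to fzero; suc to fsuc)
open import Data.Fin.Properties using (cast-involutive; cast-trans)
open import Data.Nat using (ℕ; zero; suc; pred; _+_; _*_; _≤_; _<_; _⊔_; z≤n; s≤s; s≤s⁻¹)
open import Data.Nat.Properties
open import Data.Nat.Combinatorics using (_C_; nCk+nC[k+1]≡[n+1]C[k+1])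
open import Data.Nat.ListAction using (sum)
open import Data.List using (List; []; _∷_; [_]; map; _++_; length; lookup; filter; concatMap; applyUpTo; upTo; drop)
open import Data.List.Properties using (∷-injectiveʳ; length-++; length-map; map-cong; length-removeAt′)
open import Data.List.Membership.Propositional using (_∈_; _─_; find; lose)
open import Data.List.Membership.Propositional.Properties using (∈-map⁺; ∈-map⁻; ∈-++⁺ˡ; ∈-++⁺ʳ; ∈-++⁻; ∈-lookup; ∈-concatMap⁺; ∈-concatMap⁻; ∈-applyUpTo⁺; ∈-applyUpTo⁻; ∈-upTo⁺; ∈-filter⁺; ∈-filter⁻)
open import Data.List.Relation.Unary.Any using (here; there; index)
open import Data.List.Relation.Unary.Any.Properties using (lookup-index)
open import Data.List.Relation.Unary.All as All using (All; []; _∷_)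
import Data.List.Relation.Unary.All.Properties as AllP
open import Data.List.Relation.Unary.AllPairs using ([]; _∷_)
open import Data.List.Relation.Unary.Unique.Propositional using (Unique)
import Data.List.Relation.Unary.Unique.Propositional.Properties as UniqueP
open import Data.List.Relation.Binary.Sublist.Propositional using (_⊆_; []; _∷_; _∷ʳ_)
open import Data.List.Relation.Binary.Sublist.Propositional.Properties using (All-resp-⊆; ∷⁻)
open import Data.Product using (∃; ∃₂; _×_; _,_; proj₁; proj₂)
open import Data.Sum using (inj₁; inj₂)
open import Data.Unit using (tt)
open import Function.Base using (_∘_)
open import Function.Bundles using (_⇔_; mk⇔; Equivalence)
import Function.Properties.Equivalence as ⇔
open import Relation.Nullary using (¬_; Dec; ¬?; _×-dec_)
open import Relation.Binary.PropositionalEquality using (_≡_; _≢_; refl; sym; trans; cong; cong₂; subst; subst₂; module ≡-Reasoning)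

-- Counting duplicate-free lists

private
  variable
    A B : Set

∈-─⁺ : ∀ {x z} {ys : List A} (x∈ys : x ∈ ys) → z ∈ ys → z ≢ x → z ∈ ys ─ x∈ys
∈-─⁺ (here refl) (here refl) z≢x = ⊥-elim (z≢x refl)
∈-─⁺ (here refl) (there z∈ys) _ = z∈ys
∈-─⁺ (there _) (here refl) _ = here refl
∈-─⁺ (there x∈ys) (there z∈ys) z≢x = there (∈-─⁺ x∈ys z∈ys z≢x)

Unique-length-≤ : {xs ys : List A} → Unique xs → (∀ {z} → z ∈ xs → z ∈ ys) → length xs ≤ length ys
Unique-length-≤ {xs = []} _ _ = z≤n
Unique-length-≤ {xs = x ∷ xs} {ys} (x∉xs ∷ uxs) xs⊆ys =
  subst (suc (length xs) ≤_) (sym (length-removeAt′ ys (index x∈ys)))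
    (s≤s (Unique-length-≤ uxs λ z∈xs →
      ∈-─⁺ x∈ys (xs⊆ys (there z∈xs)) (λ z≡x → All.lookup x∉xs z∈xs (sym z≡x))))
  where
  x∈ys : x ∈ ys
  x∈ys = xs⊆ys (here refl)

Unique-length-≡ : {xs ys : List A} → Unique xs → Unique ys →
  (∀ {z} → z ∈ xs → z ∈ ys) → (∀ {z} → z ∈ ys → z ∈ xs) → length xs ≡ length ys
Unique-length-≡ uxs uys xs⊆ys ys⊆xs = ≤-antisym (Unique-length-≤ uxs xs⊆ys) (Unique-length-≤ uys ys⊆xs)

sum-map-const : (xs : List A) (c : ℕ) → sum (map (λ _ → c) xs) ≡ length xs * c
sum-map-const [] c = refl
sum-map-const (x ∷ xs) c = cong (c +_) (sum-map-const xs c)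

∈-concatMap⁺′ : (F : A → List B) {xs : List A} {x : A} {y : B} → x ∈ xs → y ∈ F x → y ∈ concatMap F xs
∈-concatMap⁺′ F x∈xs y∈Fx = ∈-concatMap⁺ F (lose x∈xs y∈Fx)

∈-concatMap⁻′ : (F : A → List B) {xs : List A} {y : B} → y ∈ concatMap F xs → ∃ λ x → x ∈ xs × y ∈ F x
∈-concatMap⁻′ F = find ∘ ∈-concatMap⁻ F

concatMap-Unique : (F : A → List B) (key : B → A) {is : List A} → Unique is →
  (∀ {i} → i ∈ is → Unique (F i)) → (∀ {i x} → i ∈ is → x ∈ F i → key x ≡ i) →
  Unique (concatMap F is)
concatMap-Unique F key {[]} _ _ _ = []
concatMap-Unique F key {i ∷ is} (i∉is ∷ uis) uF key-F =
  UniqueP.++⁺ (uF (here refl)) (concatMap-Unique F key uis (uF ∘ there) (key-F ∘ there)) disjoint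
  where
  disjoint : ∀ {x} → ¬ (x ∈ F i × x ∈ concatMap F is)
  disjoint (x∈Fi , x∈rest) with j , j∈is , x∈Fj ← ∈-concatMap⁻′ F x∈rest =
    All.lookup i∉is j∈is (trans (sym (key-F (here refl) x∈Fi)) (key-F (there j∈is) x∈Fj))

Unique-map⁺-leftInverseOn : (f : A → B) (g : B → A) {xs : List A} →
  (∀ {x} → x ∈ xs → g (f x) ≡ x) → Unique xs → Unique (map f xs)
Unique-map⁺-leftInverseOn f g {[]} _ _ = []
Unique-map⁺-leftInverseOn f g {x ∷ xs} gf≡id (x∉xs ∷ uxs) =
  AllP.map⁺ (All.tabulate λ y∈xs fx≡fy →
    All.lookup x∉xs y∈xs (trans (sym (gf≡id (here refl))) (trans (cong g fx≡fy) (gf≡id (there y∈xs)))))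
  ∷ Unique-map⁺-leftInverseOn f g (gf≡id ∘ there) uxs

length-concatMap : (F : A → List B) (xs : List A) → length (concatMap F xs) ≡ sum (map (length ∘ F) xs)
length-concatMap F [] = refl
length-concatMap F (x ∷ xs) = trans (length-++ (F x)) (cong (length (F x) +_) (length-concatMap F xs))

-- Enumerations of words and of masks

InRange : ℕ → ℕ → Set
InRange k x = 1 ≤ x × x ≤ k

∈-words⁺ : ∀ k n {π} → length π ≡ n → All (InRange k) π → π ∈ words k n
∈-words⁺ k zero {[]} refl [] = here refl
∈-words⁺ k (suc n) {suc x ∷ π} len ((_ , x<k) ∷ inRange) =
  ∈-concatMap⁺′ (λ y → map (y ∷_) (words k n)) (∈-applyUpTo⁺ suc x<k)
    (∈-map⁺ (suc x ∷_) (∈-words⁺ k n (suc-injective len) inRange))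

∈-words⁻ : ∀ k n {π} → π ∈ words k n → length π ≡ n × All (InRange k) π
∈-words⁻ k zero (here refl) = refl , []
∈-words⁻ k (suc n) π∈
  with x , x∈ , π∈′ ← ∈-concatMap⁻′ (λ y → map (y ∷_) (words k n)) {applyUpTo suc k} π∈
  with π′ , π′∈ , refl ← ∈-map⁻ (x ∷_) π∈′
  with i , i<k , refl ← ∈-applyUpTo⁻ suc x∈
  with len , inRange ← ∈-words⁻ k n π′∈
  = cong suc len , (s≤s z≤n , i<k) ∷ inRange

words-Unique : ∀ k n → Unique (words k n)
words-Unique k zero = [] ∷ []
words-Unique k (suc n) =
  concatMap-Unique (λ y → map (y ∷_) (words k n)) head
    (UniqueP.applyUpTo⁺₁ suc k (λ i<j _ → <⇒≢ i<j ∘ suc-injective))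
    (λ _ → UniqueP.map⁺ ∷-injectiveʳ (words-Unique k n))
    head-∈
  where
  head : List ℕ → ℕ
  head [] = 0
  head (x ∷ _) = x
  head-∈ : ∀ {y π} → y ∈ applyUpTo suc k → π ∈ map (y ∷_) (words k n) → head π ≡ y
  head-∈ {y} _ π∈ with _ , _ , refl ← ∈-map⁻ (y ∷_) π∈ = refl

#false : List Bool → ℕ
#false [] = 0
#false (true ∷ bs) = #false bs
#false (false ∷ bs) = suc (#false bs)

#false≤length : ∀ bs → #false bs ≤ length bs
#false≤length [] = z≤n
#false≤length (true ∷ bs) = m≤n⇒m≤1+n (#false≤length bs)
#false≤length (false ∷ bs) = s≤s (#false≤length bs)

masks : ℕ → ℕ → List (List Bool)
masks zero zero = [ [] ]
masks zero (suc i) = []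
masks (suc n) zero = map (true ∷_) (masks n zero)
masks (suc n) (suc i) = map (true ∷_) (masks n (suc i)) ++ map (false ∷_) (masks n i)

length-masks : ∀ n i → length (masks n i) ≡ n C i
length-masks zero zero = refl
length-masks zero (suc i) = refl
length-masks (suc n) zero = trans (length-map (true ∷_) (masks n zero)) (length-masks n zero)
length-masks (suc n) (suc i) = begin
  length (map (true ∷_) (masks n (suc i)) ++ map (false ∷_) (masks n i))
    ≡⟨ length-++ (map (true ∷_) (masks n (suc i))) ⟩
  length (map (true ∷_) (masks n (suc i))) + length (map (false ∷_) (masks n i))
    ≡⟨ cong₂ _+_ (length-map (true ∷_) (masks n (suc i))) (length-map (false ∷_) (masks n i)) ⟩
  length (masks n (suc i)) + length (masks n i)
    ≡⟨ cong₂ _+_ (length-masks n (suc i)) (length-masks n i) ⟩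
  n C suc i + n C i
    ≡⟨ +-comm (n C suc i) (n C i) ⟩
  n C i + n C suc i
    ≡⟨ nCk+nC[k+1]≡[n+1]C[k+1] n i ⟩
  suc n C suc i ∎
  where open ≡-Reasoning

∈-masks⁺ : ∀ {bs} n i → length bs ≡ n → #false bs ≡ i → bs ∈ masks n i
∈-masks⁺ {[]} zero zero refl refl = here refl
∈-masks⁺ {true ∷ bs} (suc n) zero len f = ∈-map⁺ (true ∷_) (∈-masks⁺ n zero (suc-injective len) f)
∈-masks⁺ {true ∷ bs} (suc n) (suc i) len f =
  ∈-++⁺ˡ (∈-map⁺ (true ∷_) (∈-masks⁺ n (suc i) (suc-injective len) f))
∈-masks⁺ {false ∷ bs} (suc n) (suc i) len f =
  ∈-++⁺ʳ (map (true ∷_) (masks n (suc i))) (∈-map⁺ (false ∷_) (∈-masks⁺ n i (suc-injective len) (suc-injective f)))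

∈-masks⁻ : ∀ {bs} n i → bs ∈ masks n i → length bs ≡ n × #false bs ≡ i
∈-masks⁻ zero zero (here refl) = refl , refl
∈-masks⁻ (suc n) zero bs∈
  with bs′ , bs′∈ , refl ← ∈-map⁻ (true ∷_) bs∈
  with len , f ← ∈-masks⁻ n zero bs′∈
  = cong suc len , f
∈-masks⁻ (suc n) (suc i) bs∈ with ∈-++⁻ (map (true ∷_) (masks n (suc i))) bs∈
... | inj₁ bs∈₁
  with bs′ , bs′∈ , refl ← ∈-map⁻ (true ∷_) bs∈₁
  with len , f ← ∈-masks⁻ n (suc i) bs′∈
  = cong suc len , f
... | inj₂ bs∈₂
  with bs′ , bs′∈ , refl ← ∈-map⁻ (false ∷_) bs∈₂
  with len , f ← ∈-masks⁻ n i bs′∈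
  = cong suc len , cong suc f

masks-Unique : ∀ n i → Unique (masks n i)
masks-Unique zero zero = [] ∷ []
masks-Unique zero (suc i) = []
masks-Unique (suc n) zero = UniqueP.map⁺ ∷-injectiveʳ (masks-Unique n zero)
masks-Unique (suc n) (suc i) =
  UniqueP.++⁺ (UniqueP.map⁺ ∷-injectiveʳ (masks-Unique n (suc i))) (UniqueP.map⁺ ∷-injectiveʳ (masks-Unique n i)) disjoint
  where
  disjoint : ∀ {bs} → ¬ (bs ∈ map (true ∷_) (masks n (suc i)) × bs ∈ map (false ∷_) (masks n i))
  disjoint (bs∈₁ , bs∈₂) with _ , _ , refl ← ∈-map⁻ (true ∷_) bs∈₁ with _ , _ , () ← ∈-map⁻ (false ∷_) bs∈₂

-- Deleting and reinserting the block of 1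

Positive : List ℕ → Set
Positive = All (1 ≤_)

-- An entry 0, which never occurs in a canonical sequence, is treated like 1.
deleteBlock₁ : List ℕ → List ℕ
deleteBlock₁ [] = []
deleteBlock₁ (suc (suc x) ∷ xs) = suc x ∷ deleteBlock₁ xs
deleteBlock₁ (_ ∷ xs) = deleteBlock₁ xs

block₁Mask : List ℕ → List Bool
block₁Mask [] = []
block₁Mask (suc (suc x) ∷ xs) = false ∷ block₁Mask xs
block₁Mask (_ ∷ xs) = true ∷ block₁Mask xs

insertBlock₁ : List Bool → List ℕ → List ℕ
insertBlock₁ [] _ = []
insertBlock₁ (true ∷ bs) ys = 1 ∷ insertBlock₁ bs ys
insertBlock₁ (false ∷ bs) [] = []
insertBlock₁ (false ∷ bs) (y ∷ ys) = suc y ∷ insertBlock₁ bs ys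

insertBlock₁-block₁Mask : ∀ {z} → Positive z → insertBlock₁ (block₁Mask z) (deleteBlock₁ z) ≡ z
insertBlock₁-block₁Mask {[]} _ = refl
insertBlock₁-block₁Mask {suc zero ∷ z} (_ ∷ pos) = cong (1 ∷_) (insertBlock₁-block₁Mask pos)
insertBlock₁-block₁Mask {suc (suc x) ∷ z} (_ ∷ pos) = cong (suc (suc x) ∷_) (insertBlock₁-block₁Mask pos)

block₁Mask-insertBlock₁ : ∀ bs {ρ} → #false bs ≡ length ρ → Positive ρ → block₁Mask (insertBlock₁ bs ρ) ≡ bs
block₁Mask-insertBlock₁ [] _ _ = refl
block₁Mask-insertBlock₁ (true ∷ bs) f pos = cong (true ∷_) (block₁Mask-insertBlock₁ bs f pos)
block₁Mask-insertBlock₁ (false ∷ bs) {suc y ∷ ρ} f (_ ∷ pos) =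
  cong (false ∷_) (block₁Mask-insertBlock₁ bs (suc-injective f) pos)

deleteBlock₁-insertBlock₁ : ∀ bs {ρ} → #false bs ≡ length ρ → Positive ρ → deleteBlock₁ (insertBlock₁ bs ρ) ≡ ρ
deleteBlock₁-insertBlock₁ [] {[]} _ _ = refl
deleteBlock₁-insertBlock₁ (true ∷ bs) f pos = deleteBlock₁-insertBlock₁ bs f pos
deleteBlock₁-insertBlock₁ (false ∷ bs) {suc y ∷ ρ} f (_ ∷ pos) =
  cong (suc y ∷_) (deleteBlock₁-insertBlock₁ bs (suc-injective f) pos)

length-insertBlock₁ : ∀ bs {ρ} → #false bs ≡ length ρ → length (insertBlock₁ bs ρ) ≡ length bs
length-insertBlock₁ [] _ = refl
length-insertBlock₁ (true ∷ bs) f = cong suc (length-insertBlock₁ bs f)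
length-insertBlock₁ (false ∷ bs) {_ ∷ ρ} f = cong suc (length-insertBlock₁ bs (suc-injective f))

#false-block₁Mask : ∀ z → #false (block₁Mask z) ≡ length (deleteBlock₁ z)
#false-block₁Mask [] = refl
#false-block₁Mask (zero ∷ z) = #false-block₁Mask z
#false-block₁Mask (suc zero ∷ z) = #false-block₁Mask z
#false-block₁Mask (suc (suc x) ∷ z) = cong suc (#false-block₁Mask z)

length-block₁Mask : ∀ z → length (block₁Mask z) ≡ length z
length-block₁Mask [] = refl
length-block₁Mask (zero ∷ z) = cong suc (length-block₁Mask z)
length-block₁Mask (suc zero ∷ z) = cong suc (length-block₁Mask z)
length-block₁Mask (suc (suc x) ∷ z) = cong suc (length-block₁Mask z)

deleteBlock₁-Positive : ∀ z → Positive (deleteBlock₁ z)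
deleteBlock₁-Positive [] = []
deleteBlock₁-Positive (zero ∷ z) = deleteBlock₁-Positive z
deleteBlock₁-Positive (suc zero ∷ z) = deleteBlock₁-Positive z
deleteBlock₁-Positive (suc (suc x) ∷ z) = s≤s z≤n ∷ deleteBlock₁-Positive z

RGS-inRange : ∀ {m z} → RGS m z → All (InRange (m + length z)) z
RGS-inRange [] = []
RGS-inRange {m} {x ∷ z} ((1≤x , x≤1+m) ∷ rgs) =
  (1≤x , ≤-trans x≤1+m 1+m≤m+len) ∷ All.map (λ (1≤y , y≤) → 1≤y , ≤-trans y≤ m⊔x+len≤) (RGS-inRange rgs)
  where
  1+m≤m+len : suc m ≤ m + suc (length z)
  1+m≤m+len = ≤-trans (s≤s (m≤m+n m (length z))) (≤-reflexive (sym (+-suc m (length z))))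
  m⊔x+len≤ : m ⊔ x + length z ≤ m + suc (length z)
  m⊔x+len≤ = ≤-trans (+-monoˡ-≤ (length z) (⊔-lub (n≤1+n m) x≤1+m)) (≤-reflexive (sym (+-suc m (length z))))

RGS⇒Positive : ∀ {m z} → RGS m z → Positive z
RGS⇒Positive = All.map proj₁ ∘ RGS-inRange

RGS-deleteBlock₁ : ∀ {m z} → RGS (suc m) z → RGS m (deleteBlock₁ z)
RGS-deleteBlock₁ [] = []
RGS-deleteBlock₁ {m} {suc zero ∷ z} (_ ∷ rgs) = RGS-deleteBlock₁ (subst (λ k → RGS k z) (cong suc (⊔-identityʳ m)) rgs)
RGS-deleteBlock₁ {m} {suc (suc x) ∷ z} ((_ , s≤s x≤m) ∷ rgs) = (s≤s z≤n , x≤m) ∷ RGS-deleteBlock₁ rgs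

RGS-insertBlock₁ : ∀ {m} bs {ρ} → RGS m ρ → #false bs ≡ length ρ → RGS (suc m) (insertBlock₁ bs ρ)
RGS-insertBlock₁ [] _ _ = []
RGS-insertBlock₁ {m} (true ∷ bs) {ρ} rgs f =
  (s≤s z≤n , s≤s z≤n) ∷ subst (λ k → RGS k (insertBlock₁ bs ρ)) (sym (cong suc (⊔-identityʳ m))) (RGS-insertBlock₁ bs rgs f)
RGS-insertBlock₁ (false ∷ bs) {y ∷ ρ} ((_ , y≤1+m) ∷ rgs) f =
  (s≤s z≤n , s≤s y≤1+m) ∷ RGS-insertBlock₁ bs rgs (suc-injective f)

-- Order isomorphisms

lookup-map-cast : (f : ℕ → ℕ) (s : List ℕ) (i : Fin (length s)) .(eq : length s ≡ length (map f s)) →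
  lookup (map f s) (cast eq i) ≡ f (lookup s i)
lookup-map-cast f (x ∷ s) fzero eq = refl
lookup-map-cast f (x ∷ s) (fsuc i) eq = lookup-map-cast f s i (suc-injective eq)

OrderIso-map : (f : ℕ → ℕ) {P : ℕ → Set} {s : List ℕ} →
  (∀ {a b} → P a → P b → a < b ⇔ f a < f b) → All P s → OrderIso s (map f s)
OrderIso-map f {s = s} f-mono ps = len , λ i j →
  subst₂ (λ u v → (lookup s i < lookup s j) ⇔ (u < v))
    (sym (lookup-map-cast f s i len)) (sym (lookup-map-cast f s j len))
    (f-mono (All.lookup ps (∈-lookup i)) (All.lookup ps (∈-lookup j)))
  where
  len : length s ≡ length (map f s)
  len = sym (length-map f s)

OrderIso-suc : ∀ s → OrderIso s (map suc s)
OrderIso-suc s = OrderIso-map suc (λ _ _ → mk⇔ s≤s s≤s⁻¹) (All.universal (λ _ → tt) s)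

OrderIso-pred : ∀ {s} → Positive s → OrderIso s (map pred s)
OrderIso-pred = OrderIso-map pred λ { {suc a} {suc b} _ _ → mk⇔ s≤s⁻¹ s≤s }

OrderIso-sym : ∀ {s t} → OrderIso s t → OrderIso t s
OrderIso-sym {s} {t} (eq , iso) = sym eq , λ i j →
  ⇔.sym (subst₂ (λ u v → (lookup s (cast (sym eq) i) < lookup s (cast (sym eq) j)) ⇔ (lookup t u < lookup t v))
    (cast-involutive eq (sym eq) i) (cast-involutive eq (sym eq) j)
    (iso (cast (sym eq) i) (cast (sym eq) j)))

OrderIso-trans : ∀ {s t u} → OrderIso s t → OrderIso t u → OrderIso s u
OrderIso-trans {s} {t} {u} (eq₁ , iso₁) (eq₂ , iso₂) = trans eq₁ eq₂ , λ i j →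
  ⇔.trans (iso₁ i j)
    (subst₂ (λ v w → (lookup t (cast eq₁ i) < lookup t (cast eq₁ j)) ⇔ (lookup u v < lookup u w))
      (cast-trans eq₁ eq₂ i) (cast-trans eq₁ eq₂ j) (iso₂ (cast eq₁ i) (cast eq₁ j)))

OrderIso-tail : ∀ {x y s t} → OrderIso (x ∷ s) (y ∷ t) → OrderIso s t
OrderIso-tail (eq , iso) = suc-injective eq , λ i j → iso (fsuc i) (fsuc j)

OrderIso-head : ∀ {x y s t} (o : OrderIso (x ∷ s) (y ∷ t)) (i : Fin (length s)) →
  (x < lookup s i) ⇔ (y < lookup t (cast (suc-injective (proj₁ o)) i))
OrderIso-head (eq , iso) i = iso fzero (fsuc i)

OrderIso-∷ : ∀ {x y s t} → OrderIso s t → All (x <_) s → All (y <_) t → OrderIso (x ∷ s) (y ∷ t)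
OrderIso-∷ {x} {y} {s} {t} (eq , iso) s>x t>y = cong suc eq , iso′
  where
  iso′ : (i j : Fin (length (x ∷ s))) → _
  iso′ fzero fzero = mk⇔ (⊥-elim ∘ <-irrefl refl) (⊥-elim ∘ <-irrefl refl)
  iso′ fzero (fsuc j) = mk⇔ (λ _ → All.lookup t>y (∈-lookup _)) (λ _ → All.lookup s>x (∈-lookup j))
  iso′ (fsuc i) fzero = mk⇔ (⊥-elim ∘ <-asym (All.lookup s>x (∈-lookup i)))
                            (⊥-elim ∘ <-asym (All.lookup t>y (∈-lookup _)))
  iso′ (fsuc i) (fsuc j) = iso i j

-- Avoiding 1(τ+1)

⊆-deleteBlock₁⁺ : ∀ {s z} → s ⊆ z → All (2 ≤_) s → map pred s ⊆ deleteBlock₁ z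
⊆-deleteBlock₁⁺ [] _ = []
⊆-deleteBlock₁⁺ (zero ∷ʳ s⊆z) s≥2 = ⊆-deleteBlock₁⁺ s⊆z s≥2
⊆-deleteBlock₁⁺ (suc zero ∷ʳ s⊆z) s≥2 = ⊆-deleteBlock₁⁺ s⊆z s≥2
⊆-deleteBlock₁⁺ (suc (suc y) ∷ʳ s⊆z) s≥2 = suc y ∷ʳ ⊆-deleteBlock₁⁺ s⊆z s≥2
⊆-deleteBlock₁⁺ (_∷_ {x = suc (suc y)} refl s⊆z) (_ ∷ s≥2) = refl ∷ ⊆-deleteBlock₁⁺ s⊆z s≥2
⊆-deleteBlock₁⁺ (_∷_ {x = suc zero} refl _) (s≤s () ∷ _)

⊆-deleteBlock₁⁻ : ∀ {s} z → s ⊆ deleteBlock₁ z → map suc s ⊆ z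
⊆-deleteBlock₁⁻ [] [] = []
⊆-deleteBlock₁⁻ (zero ∷ z) s⊆ = zero ∷ʳ ⊆-deleteBlock₁⁻ z s⊆
⊆-deleteBlock₁⁻ (suc zero ∷ z) s⊆ = suc zero ∷ʳ ⊆-deleteBlock₁⁻ z s⊆
⊆-deleteBlock₁⁻ (suc (suc y) ∷ z) (_ ∷ʳ s⊆) = suc (suc y) ∷ʳ ⊆-deleteBlock₁⁻ z s⊆
⊆-deleteBlock₁⁻ (suc (suc y) ∷ z) (refl ∷ s⊆) = refl ∷ ⊆-deleteBlock₁⁻ z s⊆

map-suc-Positive>1 : ∀ {τ} → Positive τ → All (1 <_) (map suc τ)
map-suc-Positive>1 = AllP.map⁺ ∘ All.map s≤s

Contains-1∷suc⇒Contains-deleteBlock₁ : ∀ {z τ} → Positive z → Positive τ →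
  Contains (1 ∷ z) (1 ∷ map suc τ) → Contains (deleteBlock₁ z) τ
Contains-1∷suc⇒Contains-deleteBlock₁ _ _ ([] , _ , () , _)
Contains-1∷suc⇒Contains-deleteBlock₁ {τ = τ} pos-z pos-τ (a ∷ s , a∷s⊆ , iso) =
  map pred s , ⊆-deleteBlock₁⁺ (∷⁻ a∷s⊆) s≥2 ,
  OrderIso-trans {map pred s} {s} {τ} (OrderIso-sym {s} {map pred s} (OrderIso-pred (All.tail pos-a∷s)))
    (OrderIso-trans {s} {map suc τ} {τ} (OrderIso-tail {a} {1} iso) (OrderIso-sym {τ} {map suc τ} (OrderIso-suc τ)))
  where
  pos-a∷s : Positive (a ∷ s)
  pos-a∷s = All-resp-⊆ a∷s⊆ (s≤s z≤n ∷ pos-z)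
  s>a : All (a <_) s
  s>a = All.tabulate λ x∈s → subst (a <_) (sym (lookup-index x∈s))
    (Equivalence.from (OrderIso-head iso (index x∈s)) (All.lookup (map-suc-Positive>1 pos-τ) (∈-lookup _)))
  s≥2 : All (2 ≤_) s
  s≥2 = All.map (≤-trans (s≤s (All.head pos-a∷s))) s>a

Contains-deleteBlock₁⇒Contains-1∷suc : ∀ {z τ} → Positive τ →
  Contains (deleteBlock₁ z) τ → Contains (1 ∷ z) (1 ∷ map suc τ)
Contains-deleteBlock₁⇒Contains-1∷suc {z} {τ} pos-τ (s , s⊆ , iso) =
  1 ∷ map suc s , refl ∷ ⊆-deleteBlock₁⁻ z s⊆ ,
  OrderIso-∷ {s = map suc s} {map suc τ}
    (OrderIso-trans {map suc s} {s} {map suc τ} (OrderIso-sym {s} {map suc s} (OrderIso-suc s))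
      (OrderIso-trans {s} {τ} {map suc τ} iso (OrderIso-suc τ)))
    (map-suc-Positive>1 (All-resp-⊆ s⊆ (deleteBlock₁-Positive z))) (map-suc-Positive>1 pos-τ)

Avoids-1∷suc⇔Avoids-deleteBlock₁ : ∀ {z τ} → Positive z → Positive τ →
  Avoids (1 ∷ z) (1 ∷ map suc τ) ⇔ Avoids (deleteBlock₁ z) τ
Avoids-1∷suc⇔Avoids-deleteBlock₁ pos-z pos-τ =
  mk⇔ (_∘ Contains-deleteBlock₁⇒Contains-1∷suc pos-τ) (_∘ Contains-1∷suc⇒Contains-deleteBlock₁ pos-z pos-τ)

canonicalAvoider? : (σ π : List ℕ) → Dec (Canonical π × Avoids π σ)
canonicalAvoider? σ π = rgs? 0 π ×-dec ¬? (contains? π σ)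

-- Definitionally, p n σ ≡ length (avoiders σ n).
avoiders : List ℕ → ℕ → List (List ℕ)
avoiders σ n = filter (canonicalAvoider? σ) (words n n)

∈-avoiders⁺ : ∀ σ n {π} → length π ≡ n → Canonical π → Avoids π σ → π ∈ avoiders σ n
∈-avoiders⁺ σ n {π} len canonical avoids =
  ∈-filter⁺ (canonicalAvoider? σ) (∈-words⁺ n n len (subst (λ k → All (InRange k) π) len (RGS-inRange canonical)))
    (canonical , avoids)

∈-avoiders⁻ : ∀ σ n {π} → π ∈ avoiders σ n → length π ≡ n × Canonical π × Avoids π σ
∈-avoiders⁻ σ n π∈ with π∈words , canonical , avoids ← ∈-filter⁻ (canonicalAvoider? σ) {xs = words n n} π∈ =
  proj₁ (∈-words⁻ n n π∈words) , canonical , avoids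

avoiders-Unique : ∀ σ n → Unique (avoiders σ n)
avoiders-Unique σ n = UniqueP.filter⁺ (canonicalAvoider? σ) (words-Unique n n)

module Decomposition (τ : List ℕ) (n : ℕ) where

  σ : List ℕ
  σ = 1 ∷ map suc τ

  glue : List Bool → List ℕ → List ℕ
  glue bs ρ = 1 ∷ insertBlock₁ bs ρ

  glued : ℕ → List (List ℕ)
  glued i = concatMap (λ bs → map (glue bs) (avoiders τ i)) (masks n i)

  allGlued : List (List ℕ)
  allGlued = concatMap glued (upTo (suc n))

  glue-compatible : ∀ {i bs ρ} → bs ∈ masks n i → ρ ∈ avoiders τ i → #false bs ≡ length ρ × Positive ρ
  glue-compatible {i} bs∈ ρ∈ with _ , #false≡i ← ∈-masks⁻ n i bs∈ with len , canonical , _ ← ∈-avoiders⁻ τ i ρ∈ =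
    trans #false≡i (sym len) , RGS⇒Positive canonical

  ∈-glued⁻ : ∀ {i z} → z ∈ glued i → ∃₂ λ bs ρ → bs ∈ masks n i × ρ ∈ avoiders τ i × z ≡ glue bs ρ
  ∈-glued⁻ {i} z∈
    with bs , bs∈ , z∈′ ← ∈-concatMap⁻′ (λ bs → map (glue bs) (avoiders τ i)) {masks n i} z∈
    with ρ , ρ∈ , z≡ ← ∈-map⁻ (glue bs) z∈′
    = bs , ρ , bs∈ , ρ∈ , z≡

  ∈-allGlued⁺ : ∀ {i bs ρ} → i ≤ n → bs ∈ masks n i → ρ ∈ avoiders τ i → glue bs ρ ∈ allGlued
  ∈-allGlued⁺ {i} {bs} i≤n bs∈ ρ∈ =
    ∈-concatMap⁺′ glued (∈-upTo⁺ (s≤s i≤n)) (∈-concatMap⁺′ (λ bs → map (glue bs) (avoiders τ i)) bs∈ (∈-map⁺ (glue bs) ρ∈))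

  ∈-allGlued⁻ : ∀ {z} → z ∈ allGlued → ∃₂ λ i bs → ∃ λ ρ → bs ∈ masks n i × ρ ∈ avoiders τ i × z ≡ glue bs ρ
  ∈-allGlued⁻ z∈ with i , _ , z∈ᵢ ← ∈-concatMap⁻′ glued {upTo (suc n)} z∈ = i , ∈-glued⁻ z∈ᵢ

  module _ (pos-τ : Positive τ) where

    avoider⇒glued : ∀ {z} → z ∈ avoiders σ (suc n) → z ∈ allGlued
    avoider⇒glued z∈ with ∈-avoiders⁻ σ (suc n) z∈
    avoider⇒glued {[]} _ | () , _ , _
    avoider⇒glued {zero ∷ _} _ | _ , ((() , _) ∷ _) , _
    avoider⇒glued {suc (suc _) ∷ _} _ | _ , ((_ , s≤s ()) ∷ _) , _
    avoider⇒glued {suc zero ∷ z} _ | len , (_ ∷ rgs) , avoids =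
      subst (_∈ allGlued) (cong (1 ∷_) (insertBlock₁-block₁Mask pos-z))
        (∈-allGlued⁺ i≤n (∈-masks⁺ n i len-mask (#false-block₁Mask z))
          (∈-avoiders⁺ τ i refl (RGS-deleteBlock₁ rgs) (Equivalence.to (Avoids-1∷suc⇔Avoids-deleteBlock₁ pos-z pos-τ) avoids)))
      where
      pos-z : Positive z
      pos-z = RGS⇒Positive rgs
      i : ℕ
      i = length (deleteBlock₁ z)
      len-mask : length (block₁Mask z) ≡ n
      len-mask = trans (length-block₁Mask z) (suc-injective len)
      i≤n : i ≤ n
      i≤n = subst₂ _≤_ (#false-block₁Mask z) len-mask (#false≤length (block₁Mask z))

    glued⇒avoider : ∀ {z} → z ∈ allGlued → z ∈ avoiders σ (suc n)
    glued⇒avoider z∈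
      with i , bs , ρ , bs∈ , ρ∈ , refl ← ∈-allGlued⁻ z∈
      with len-bs , _ ← ∈-masks⁻ n i bs∈
      with _ , canonical-ρ , avoids-ρ ← ∈-avoiders⁻ τ i ρ∈
      with #false≡ , pos-ρ ← glue-compatible bs∈ ρ∈
      = ∈-avoiders⁺ σ (suc n) (cong suc (trans (length-insertBlock₁ bs #false≡) len-bs)) canonical
          (Equivalence.from (Avoids-1∷suc⇔Avoids-deleteBlock₁ (All.tail (RGS⇒Positive canonical)) pos-τ)
            (subst (λ π → Avoids π τ) (sym (deleteBlock₁-insertBlock₁ bs #false≡ pos-ρ)) avoids-ρ))
      where
      canonical : Canonical (glue bs ρ)
      canonical = (s≤s z≤n , s≤s z≤n) ∷ RGS-insertBlock₁ bs canonical-ρ #false≡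

  allGlued-Unique : Unique allGlued
  allGlued-Unique = concatMap-Unique glued (length ∘ deleteBlock₁ ∘ drop 1) (UniqueP.upTo⁺ (suc n)) glued-Unique size
    where
    glued-Unique : ∀ {i} → i ∈ upTo (suc n) → Unique (glued i)
    glued-Unique {i} _ =
      concatMap-Unique (λ bs → map (glue bs) (avoiders τ i)) (block₁Mask ∘ drop 1) (masks-Unique n i)
        (λ {bs} bs∈ → Unique-map⁺-leftInverseOn (glue bs) (deleteBlock₁ ∘ drop 1)
          (λ ρ∈ → let f , pos = glue-compatible bs∈ ρ∈ in deleteBlock₁-insertBlock₁ bs f pos)
          (avoiders-Unique τ i))
        mask
      where
      mask : ∀ {bs z} → bs ∈ masks n i → z ∈ map (glue bs) (avoiders τ i) → block₁Mask (drop 1 z) ≡ bs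
      mask {bs} bs∈ z∈ with ρ , ρ∈ , refl ← ∈-map⁻ (glue bs) z∈ =
        let f , pos = glue-compatible bs∈ ρ∈ in block₁Mask-insertBlock₁ bs f pos
    size : ∀ {i z} → i ∈ upTo (suc n) → z ∈ glued i → length (deleteBlock₁ (drop 1 z)) ≡ i
    size _ z∈ with bs , ρ , bs∈ , ρ∈ , refl ← ∈-glued⁻ z∈ =
      let f , pos = glue-compatible bs∈ ρ∈ in
      trans (cong length (deleteBlock₁-insertBlock₁ bs f pos)) (proj₁ (∈-avoiders⁻ τ _ ρ∈))

  length-glued : ∀ i → length (glued i) ≡ (n C i) * p i τ
  length-glued i = begin
    length (glued i)
      ≡⟨ length-concatMap (λ bs → map (glue bs) (avoiders τ i)) (masks n i) ⟩
    sum (map (λ bs → length (map (glue bs) (avoiders τ i))) (masks n i))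
      ≡⟨ cong sum (map-cong (λ bs → length-map (glue bs) (avoiders τ i)) (masks n i)) ⟩
    sum (map (λ _ → p i τ) (masks n i))
      ≡⟨ sum-map-const (masks n i) (p i τ) ⟩
    length (masks n i) * p i τ
      ≡⟨ cong (_* p i τ) (length-masks n i) ⟩
    (n C i) * p i τ ∎
    where open ≡-Reasoning

  length-allGlued : length allGlued ≡ sum (map (λ i → (n C i) * p i τ) (upTo (suc n)))
  length-allGlued = trans (length-concatMap glued (upTo (suc n))) (cong sum (map-cong length-glued (upTo (suc n))))

mainTheorem2 : (τ : List ℕ) → Canonical τ → (n : ℕ) →
    p (suc n) (1 ∷ map suc τ) ≡ sum (map (λ i → (n C i) * p i τ) (upTo (suc n)))
mainTheorem2 τ canonical-τ n = begin
  p (suc n) (1 ∷ map suc τ)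
    ≡⟨ Unique-length-≡ (avoiders-Unique σ (suc n)) allGlued-Unique
         (avoider⇒glued pos-τ) (glued⇒avoider pos-τ) ⟩
  length allGlued
    ≡⟨ length-allGlued ⟩
  sum (map (λ i → (n C i) * p i τ) (upTo (suc n))) ∎
  where
  open Decomposition τ n
  open ≡-Reasoning
  pos-τ : Positive τ
  pos-τ = RGS⇒Positive canonical-τ
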